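{- Let $q$ be a prime power and $n$ an odd positive integer with $\gcd(n,q)=1$. Let $t$ be an integer with $\gcd(t,n)=1$ such that $t$ is not congruent modulo $n$ to any power $(q^2)^j$, $j\ge0$, while $t^2\equiv(q^2)^j\pmod n$ for some nonnegative integer $j$. Then $\mu_t$ gives a splitting of $n$ over $\mathbb{F}_{q^2}$ if and only if $\gcd(n,q^{2i}-t)=1$ for every integer $i\ge1$.
   Context: The $q^2$-cyclotomic coset of $s$ modulo $n$ is $\{s(q^2)^j\bmod n:j\ge0\}$. For $\gcd(b,n)=1$, $\mu_b$ gives a splitting of $n$ over $\mathbb{F}_{q^2}$ if there are sets $S_1,S_2$, each a union of $q^2$-cyclotomic cosets modulo $n$, with $S_1\cup S_2=\{1,\dots,n-1\}$, $S_1\cap S_2=\emptyset$, $bS_1\equiv S_2$ and $bS_2\equiv S_1\pmod n$. -}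

module Defs where

open import Level using (0ℓ)
open import Data.Nat using (ℕ; _*_; _^_; _%_; _≤_; _<_; NonZero)
open import Data.Nat.Primality using (Prime)
open import Data.Integer as ℤ using (ℤ; +_)
open import Data.Integer.DivMod using (_%ℕ_)
open import Data.Product using (Σ; ∃; _×_)
open import Data.Sum using (_⊎_)
open import Data.Empty using (⊥)
open import Function.Bundles using (_⇔_)
open import Relation.Binary.PropositionalEquality using (_≡_)

IsPrimePower : ℕ → Set
IsPrimePower q = Σ ℕ λ p → Σ ℕ λ k → Prime p × 1 ≤ k × q ≡ p ^ k

Subset : Set₁
Subset = ℕ → Set

cycCoset : (q n : ℕ) .{{_ : NonZero n}} → ℕ → Subset
cycCoset q n s x = ∃ λ j → x ≡ (s * (q ^ 2) ^ j) % n

-- S is a union of q²-cyclotomic cosets modulo n: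
-- S consists of residues mod n and contains the coset of each of its elements
-- (so S is exactly the union of the cosets of its elements)
IsUnionOfCosets : (q n : ℕ) .{{_ : NonZero n}} → Subset → Set
IsUnionOfCosets q n S =
  (∀ x → S x → x < n) × (∀ s → S s → ∀ x → cycCoset q n s x → S x)

MulSetEq : (n : ℕ) .{{_ : NonZero n}} → ℤ → Subset → Subset → Set
MulSetEq n b S T = ∀ y → T y ⇔ (∃ λ s → S s × y ≡ (b ℤ.* + s) %ℕ n)

GivesSplitting : (q n : ℕ) .{{_ : NonZero n}} → ℤ → Set₁
GivesSplitting q n b =
  Σ Subset λ S₁ → Σ Subset λ S₂ →
    IsUnionOfCosets q n S₁ × IsUnionOfCosets q n S₂ ×
    (∀ x → (S₁ x ⊎ S₂ x) ⇔ (1 ≤ x × x < n)) ×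
    (∀ x → S₁ x → S₂ x → ⊥) ×
    MulSetEq n b S₁ S₂ × MulSetEq n b S₂ S₁

-- Put g = q² and μ x = t x mod n. Since gcd(n, q) = 1 the powers of g are periodic modulo n, so each
-- q²-cyclotomic coset is the finite orbit {x gʲ mod n} and has a least element. Multiplication by t
-- maps cosets to cosets, and μ ∘ μ preserves each coset because t² is a power of g.
-- A residue s ≠ 0 with t s ≡ gⁱ s exists iff some gⁱ − t shares a factor d > 1 with n (take s = n / d),
-- and i ≥ 1 can always be arranged by adding a period; so the gcd condition says that μ fixes no coset
-- besides {0}. If μ fixed the coset of some s ≠ 0, then s and t s would lie in the same part of any
-- splitting, although t swaps the parts. Otherwise the nonzero cosets pair off as {C, μ C}, and a
-- splitting is obtained by putting x into S₁ when the least element of its coset is below that of the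
-- coset of μ x.
module Submission where

open import Defs
open import Level using (0ℓ)
open import Data.Nat as ℕ using (ℕ; zero; suc; NonZero; _^_; _≤_; _<_; _>_)
import Data.Nat.Properties as ℕP
open import Data.Nat.DivMod using (_%_; _/_; m<n⇒m%n≡m; m%n<n; m≡m%n+[m/n]*n)
open import Data.Nat.Divisibility using (_∣_; divides; ∣-trans; *-monoʳ-∣; >⇒∤; n∣m⇒m%n≡0)
open import Data.Nat.Coprimality as ℕC using (Coprime)
open import Data.Nat.GCD using (gcd; gcd[m,n]∣m; gcd[m,n]∣n; gcd[m,n]≡0⇒m≡0)
open import Data.Integer as ℤ using (ℤ; +_; _-_)
import Data.Integer.Properties as ℤP
open import Data.Integer.DivMod using (_%ℕ_; _/ℕ_; n%ℕd<d; a≡a%ℕn+[a/ℕn]*n)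
import Data.Integer.Divisibility.Signed as S
import Data.Integer.Coprimality as ℤC
open import Data.Integer.GCD as ℤG using ()
open import Data.Integer.Divisibility as ℤD using ()
open import Data.Integer.Tactic.RingSolver using (solve-∀)
open import Data.Fin using (toℕ; fromℕ<)
open import Data.Fin.Properties using (pigeonhole; toℕ-fromℕ<)
open import Data.List using (upTo)
open import Data.List.Relation.Unary.All using (lookup)
open import Data.List.Membership.Propositional.Properties using (∈-upTo⁺)
open import Data.List.Extrema ℕP.≤-totalOrder using (argmin; f[argmin]≤f[xs])
open import Data.Product using (∃; _×_; _,_; proj₁; proj₂)
open import Data.Sum as Sum using (_⊎_; inj₁; inj₂)
open import Data.Empty using (⊥)
open import Function using (_∘_; flip)
open import Function.Bundles using (_⇔_; mk⇔; Equivalence)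
open import Relation.Nullary using (¬_; yes; no; contradiction)
open import Relation.Binary.Bundles using (Setoid)
open import Relation.Binary.Definitions using (Reflexive; Symmetric; Transitive)
open import Relation.Binary.PropositionalEquality

coprime-* : ∀ {n a b} → Coprime n a → Coprime n b → Coprime n (a ℕ.* b)
coprime-* {n} {a} n⊥a n⊥b {d} (d∣n , d∣ab) = n⊥b (d∣n , ℕC.coprime-divisor d⊥a d∣ab)
  where
  d⊥a : Coprime d a
  d⊥a (e∣d , e∣a) = n⊥a (∣-trans e∣d d∣n , e∣a)

coprime-^ : ∀ {n a} → Coprime n a → ∀ k → Coprime n (a ^ k)
coprime-^ {n} _ zero = ℕC.sym (ℕC.1-coprimeTo n)
coprime-^ n⊥a (suc k) = coprime-* n⊥a (coprime-^ n⊥a k)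

¬coprime⇒zero-divisor : ∀ {n u} .{{_ : NonZero n}} → ¬ Coprime n u →
                        ∃ λ s → 1 ≤ s × s < n × n ∣ u ℕ.* s
¬coprime⇒zero-divisor {n} {u} ¬n⊥u with gcd[m,n]∣m n u
... | divides s n≡s*d = s , 1≤s , s<n , n∣u*s
  where
  d : ℕ
  d = gcd n u
  1<d : 1 < d
  1<d = ℕP.≤∧≢⇒< (ℕP.n≢0⇒n>0 (ℕ.≢-nonZero⁻¹ n ∘ gcd[m,n]≡0⇒m≡0)) (¬n⊥u ∘ ℕC.gcd≡1⇒coprime ∘ sym)
  1≤s : 1 ≤ s
  1≤s = ℕP.n≢0⇒n>0 (λ s≡0 → ℕ.≢-nonZero⁻¹ n (trans n≡s*d (cong (ℕ._* d) s≡0)))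
  s<n : s < n
  s<n = subst (s <_) (sym n≡s*d) (ℕP.m<m*n s d {{ℕ.>-nonZero 1≤s}} 1<d)
  n∣u*s : n ∣ u ℕ.* s
  n∣u*s = subst₂ _∣_ (sym n≡s*d) (ℕP.*-comm s u) (*-monoʳ-∣ s (gcd[m,n]∣n n u))

gcd≡1⇔coprime : ∀ i j → ℤG.gcd i j ≡ + 1 ⇔ ℤC.Coprime i j
gcd≡1⇔coprime _ _ = mk⇔ (ℕC.gcd≡1⇒coprime ∘ ℤP.+-injective) (cong +_ ∘ ℕC.coprime⇒gcd≡1)

≢⇒<⊎> : ∀ {a b} → a ≢ b → a < b ⊎ a > b
≢⇒<⊎> {a} {b} a≢b =
  Sum.map (λ a≤b → ℕP.≤∧≢⇒< a≤b a≢b) (λ b≤a → ℕP.≤∧≢⇒< b≤a (a≢b ∘ sym)) (ℕP.≤-total a b)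

module Congruence (n : ℕ) .{{_ : NonZero n}} where
  open import Data.Integer using (_*_; _+_; -_)

  -- A record rather than a synonym for + n ∣ a - b, so that a and b can be inferred.
  infix 4 _≈_
  record _≈_ (a b : ℤ) : Set where
    constructor mk≈
    field n∣a-b : + n S.∣ a - b

  ≈-refl : Reflexive _≈_
  ≈-refl {a} = mk≈ (S.divides (+ 0) (ℤP.+-inverseʳ a))

  ≈-sym : Symmetric _≈_
  ≈-sym {a} {b} (mk≈ n∣a-b) = mk≈ (subst (+ n S.∣_) (negate a b) (S.∣m⇒∣-m n∣a-b))
    where
    negate : ∀ a b → - (a - b) ≡ b - a
    negate = solve-∀

  ≈-trans : Transitive _≈_
  ≈-trans {a} {b} {c} (mk≈ n∣a-b) (mk≈ n∣b-c) =
    mk≈ (subst (+ n S.∣_) (telescope a b c) (S.∣m∣n⇒∣m+n n∣a-b n∣b-c))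
    where
    telescope : ∀ a b c → (a - b) + (b - c) ≡ a - c
    telescope = solve-∀

  ≈-setoid : Setoid 0ℓ 0ℓ
  ≈-setoid = record
    { Carrier = ℤ
    ; _≈_ = _≈_
    ; isEquivalence = record { refl = ≈-refl ; sym = ≈-sym ; trans = ≈-trans }
    }

  open import Relation.Binary.Reasoning.Setoid ≈-setoid

  *-cong : ∀ {a b c d} → a ≈ b → c ≈ d → a * c ≈ b * d
  *-cong {a} {b} {c} {d} (mk≈ n∣a-b) (mk≈ n∣c-d) =
    mk≈ (subst (+ n S.∣_) (expand a b c d) (S.∣m∣n⇒∣m+n (S.∣m⇒∣m*n c n∣a-b) (S.∣n⇒∣m*n b n∣c-d)))
    where
    expand : ∀ a b c d → (a - b) * c + b * (c - d) ≡ a * c - b * d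
    expand = solve-∀

  *-congˡ : ∀ c {a b} → a ≈ b → c * a ≈ c * b
  *-congˡ c = *-cong (≈-refl {c})

  *-congʳ : ∀ c {a b} → a ≈ b → a * c ≈ b * c
  *-congʳ c a≈b = *-cong a≈b (≈-refl {c})

  ≈-%ℕ : ∀ a → a ≈ + (a %ℕ n)
  ≈-%ℕ a = mk≈ (S.divides (a /ℕ n) (trans (cong (_- + (a %ℕ n)) (a≡a%ℕn+[a/ℕn]*n a n))
                                          (cancel (+ (a %ℕ n)) (a /ℕ n) (+ n))))
    where
    cancel : ∀ r q m → r + q * m - r ≡ q * m
    cancel = solve-∀

  ≈⇒≡-≤ : ∀ {x y} → x ≤ y → y < n → + y ≈ + x → y ≡ x
  ≈⇒≡-≤ {x} {y} x≤y y<n (mk≈ n∣y-x) = ℕP.≤-antisym (ℕP.m∸n≡0⇒m≤n y∸x≡0) x≤y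
    where
    n∣y∸x : n ∣ y ℕ.∸ x
    n∣y∸x = S.∣⇒∣ᵤ (subst (+ n S.∣_) (trans (ℤP.m-n≡m⊖n y x) (ℤP.⊖-≥ x≤y)) n∣y-x)
    y∸x≡0 : y ℕ.∸ x ≡ 0
    y∸x≡0 = trans (sym (m<n⇒m%n≡m (ℕP.≤-<-trans (ℕP.m∸n≤m y x) y<n))) (n∣m⇒m%n≡0 _ n n∣y∸x)

  ≈⇒≡ : ∀ {x y} → x < n → y < n → + x ≈ + y → x ≡ y
  ≈⇒≡ {x} {y} x<n y<n x≈y = Sum.[ (λ x≤y → sym (≈⇒≡-≤ x≤y y<n (≈-sym x≈y)))
                                 , (λ y≤x → ≈⇒≡-≤ y≤x x<n x≈y) ]′ (ℕP.≤-total x y)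

  %ℕ-cong : ∀ {a b} → a ≈ b → a %ℕ n ≡ b %ℕ n
  %ℕ-cong {a} {b} a≈b = ≈⇒≡ (n%ℕd<d a n) (n%ℕd<d b n) (begin
    + (a %ℕ n)   ≈⟨ ≈-sym (≈-%ℕ a) ⟩
    a            ≈⟨ a≈b ⟩
    b            ≈⟨ ≈-%ℕ b ⟩
    + (b %ℕ n)   ∎)

  *-cancelˡ : ∀ {c a b} → Coprime n c → + c * a ≈ + c * b → a ≈ b
  *-cancelˡ {c} {a} {b} n⊥c (mk≈ n∣ca-cb) =
    mk≈ (S.∣ᵤ⇒∣ (ℤC.coprime-divisor (+ n) (+ c) (a - b) n⊥c
                   (S.∣⇒∣ᵤ (subst (+ n S.∣_) (factor (+ c) a b) n∣ca-cb))))
    where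
    factor : ∀ c a b → c * a - c * b ≡ c * (a - b)
    factor = solve-∀

  ≈⇔∣-* : ∀ a b x → (x * a ≈ b * x) ⇔ (+ n S.∣ (a - b) * x)
  ≈⇔∣-* a b x = mk⇔ (λ (mk≈ n∣xa-bx) → subst (+ n S.∣_) (factor a b x) n∣xa-bx)
                    (λ n∣[a-b]x → mk≈ (subst (+ n S.∣_) (sym (factor a b x)) n∣[a-b]x))
    where
    factor : ∀ a b x → x * a - b * x ≡ (a - b) * x
    factor = solve-∀

  -- Two of the first n + 1 powers of g agree modulo n; cancel the smaller one.
  period : ∀ {g} → Coprime n g → ∃ λ k → + (g ^ suc k) ≈ + 1
  period {g} n⊥g with pigeonhole (ℕP.n<1+n n) (λ i → fromℕ< (n%ℕd<d (+ (g ^ toℕ i)) n))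
  ... | i , j , i<j , same with ℕP.m≤n⇒∃[o]m+o≡n i<j
  ...   | k , i+1+k≡j = k , ≈-sym (*-cancelˡ (coprime-^ n⊥g (toℕ i)) g^i≈g^i*g^[1+k])
    where
    same-residue : + (g ^ toℕ i) %ℕ n ≡ + (g ^ toℕ j) %ℕ n
    same-residue = trans (sym (toℕ-fromℕ< _)) (trans (cong toℕ same) (toℕ-fromℕ< _))
    g^i≈g^j : + (g ^ toℕ i) ≈ + (g ^ toℕ j)
    g^i≈g^j = begin
      + (g ^ toℕ i)              ≈⟨ ≈-%ℕ _ ⟩
      + (+ (g ^ toℕ i) %ℕ n)     ≡⟨ cong +_ same-residue ⟩
      + (+ (g ^ toℕ j) %ℕ n)     ≈⟨ ≈-sym (≈-%ℕ _) ⟩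
      + (g ^ toℕ j)              ∎
    g^j≡g^i*g^[1+k] : g ^ toℕ j ≡ g ^ toℕ i ℕ.* g ^ suc k
    g^j≡g^i*g^[1+k] = trans (cong (g ^_) (trans (sym i+1+k≡j) (sym (ℕP.+-suc (toℕ i) k))))
                            (ℕP.^-distribˡ-+-* g (toℕ i) (suc k))
    g^i≈g^i*g^[1+k] : + (g ^ toℕ i) * + 1 ≈ + (g ^ toℕ i) * + (g ^ suc k)
    g^i≈g^i*g^[1+k] = begin
      + (g ^ toℕ i) * + 1                 ≡⟨ ℤP.*-identityʳ _ ⟩
      + (g ^ toℕ i)                       ≈⟨ g^i≈g^j ⟩
      + (g ^ toℕ j)                       ≡⟨ cong +_ g^j≡g^i*g^[1+k] ⟩
      + (g ^ toℕ i ℕ.* g ^ suc k)         ≡⟨ ℤP.pos-* (g ^ toℕ i) (g ^ suc k) ⟩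
      + (g ^ toℕ i) * + (g ^ suc k)       ∎

module Cyclotomic (q n : ℕ) .{{_ : NonZero n}} where
  open import Data.Integer using (_*_)
  open Congruence n
  open import Relation.Binary.Reasoning.Setoid ≈-setoid

  g : ℕ
  g = q ^ 2

  orbit : ℕ → ℕ → ℕ
  orbit x j = (x ℕ.* g ^ j) % n

  Coset : ℕ → ℕ → Set
  Coset = cycCoset q n

  orbit-< : ∀ x j → orbit x j < n
  orbit-< x j = m%n<n (x ℕ.* g ^ j) n

  orbit-≈ : ∀ x j → + orbit x j ≈ + x * + (g ^ j)
  orbit-≈ x j = begin
    + orbit x j         ≈⟨ ≈-sym (≈-%ℕ _) ⟩
    + (x ℕ.* g ^ j)     ≡⟨ ℤP.pos-* x (g ^ j) ⟩
    + x * + (g ^ j)     ∎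

  ≈⇒coset : ∀ {a} x j → a ≈ + x * + (g ^ j) → Coset x (a %ℕ n)
  ≈⇒coset {a} x j a≈x*g^j = j , %ℕ-cong (begin
    a                   ≈⟨ a≈x*g^j ⟩
    + x * + (g ^ j)     ≡⟨ ℤP.pos-* x (g ^ j) ⟨
    + (x ℕ.* g ^ j)     ∎)

  orbit-orbit : ∀ x i j → orbit (orbit x i) j ≡ orbit x (i ℕ.+ j)
  orbit-orbit x i j = proj₂ (≈⇒coset x (i ℕ.+ j) (begin
    + (orbit x i ℕ.* g ^ j)            ≡⟨ ℤP.pos-* (orbit x i) (g ^ j) ⟩
    + orbit x i * + (g ^ j)            ≈⟨ *-congʳ (+ (g ^ j)) (orbit-≈ x i) ⟩
    + x * + (g ^ i) * + (g ^ j)        ≡⟨ ℤP.*-assoc (+ x) (+ (g ^ i)) (+ (g ^ j)) ⟩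
    + x * (+ (g ^ i) * + (g ^ j))      ≡⟨ cong (+ x *_) (ℤP.pos-* (g ^ i) (g ^ j)) ⟨
    + x * + (g ^ i ℕ.* g ^ j)          ≡⟨ cong (λ e → + x * + e) (ℕP.^-distribˡ-+-* g i j) ⟨
    + x * + (g ^ (i ℕ.+ j))            ∎))

  orbit-identity : ∀ {x} → x < n → orbit x 0 ≡ x
  orbit-identity {x} x<n = trans (cong (_% n) (ℕP.*-identityʳ x)) (m<n⇒m%n≡m x<n)

  orbit-of-0 : ∀ j → orbit 0 j ≡ 0
  orbit-of-0 j = m<n⇒m%n≡m (ℕ.>-nonZero⁻¹ n)

  coset-< : ∀ {x y} → Coset x y → y < n
  coset-< {x} (j , refl) = orbit-< x j

  coset-trans : ∀ {x y z} → Coset x y → Coset y z → Coset x z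
  coset-trans {x} (i , refl) (j , refl) = i ℕ.+ j , orbit-orbit x i j

  μ : ℤ → ℕ → ℕ
  μ b x = (b * + x) %ℕ n

  μ-< : ∀ b x → μ b x < n
  μ-< b x = n%ℕd<d (b * + x) n

  μ-zero : ∀ b → μ b 0 ≡ 0
  μ-zero b = trans (cong (_%ℕ n) (ℤP.*-zeroʳ b)) (m<n⇒m%n≡m (ℕ.>-nonZero⁻¹ n))

  μ-orbit : ∀ b x j → μ b (orbit x j) ≡ orbit (μ b x) j
  μ-orbit b x j = proj₂ (≈⇒coset (μ b x) j (begin
    b * + orbit x j              ≈⟨ *-congˡ b (orbit-≈ x j) ⟩
    b * (+ x * + (g ^ j))        ≡⟨ ℤP.*-assoc b (+ x) (+ (g ^ j)) ⟨
    b * + x * + (g ^ j)          ≈⟨ *-congʳ (+ (g ^ j)) (≈-%ℕ (b * + x)) ⟩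
    + μ b x * + (g ^ j)          ∎))

  μ-coset : ∀ b {x y} → Coset x y → Coset (μ b x) (μ b y)
  μ-coset b {x} (j , refl) = j , μ-orbit b x j

  FixesNoCoset : ℤ → Set
  FixesNoCoset b = ∀ s → 1 ≤ s → s < n → ¬ Coset s (μ b s)

  splitting⇒fixesNoCoset : ∀ b → GivesSplitting q n b → FixesNoCoset b
  splitting⇒fixesNoCoset _
    (S₁ , S₂ , (_ , closed₁) , (_ , closed₂) , cover , disjoint , bS₁≡S₂ , bS₂≡S₁) s 1≤s s<n s~bs
    with Equivalence.from (cover s) (1≤s , s<n)
  ... | inj₁ s∈S₁ = disjoint _ (closed₁ s s∈S₁ _ s~bs) (Equivalence.from (bS₁≡S₂ _) (s , s∈S₁ , refl))
  ... | inj₂ s∈S₂ = disjoint _ (Equivalence.from (bS₂≡S₁ _) (s , s∈S₂ , refl)) (closed₂ s s∈S₂ _ s~bs)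

  fixesNoCoset⇒coprime : ∀ b → FixesNoCoset b → ∀ i → ℤC.Coprime (+ n) (+ (g ^ i) - b)
  fixesNoCoset⇒coprime b fixes i with ℤC.coprime? (+ n) (+ (g ^ i) - b)
  ... | yes n⊥g^i-b = n⊥g^i-b
  ... | no ¬n⊥g^i-b with ¬coprime⇒zero-divisor ¬n⊥g^i-b
  ...   | s , 1≤s , s<n , n∣u*s = contradiction (≈⇒coset s i (≈-sym s*g^i≈b*s)) (fixes s 1≤s s<n)
    where
    s*g^i≈b*s : + s * + (g ^ i) ≈ b * + s
    s*g^i≈b*s = Equivalence.from (≈⇔∣-* (+ (g ^ i)) b (+ s))
                  (S.∣ᵤ⇒∣ (subst (n ∣_) (sym (ℤP.abs-* (+ (g ^ i) - b) (+ s))) n∣u*s))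

  module Periodic (k : ℕ) (g^p≈1 : + (g ^ suc k) ≈ + 1) where
    p : ℕ
    p = suc k

    orbit-period : ∀ {x} → x < n → orbit x p ≡ x
    orbit-period {x} x<n = trans (%ℕ-cong (begin
      + (x ℕ.* g ^ p)   ≡⟨ ℤP.pos-* x (g ^ p) ⟩
      + x * + (g ^ p)   ≈⟨ *-congˡ (+ x) g^p≈1 ⟩
      + x * + 1         ≡⟨ ℤP.*-identityʳ (+ x) ⟩
      + x               ∎)) (m<n⇒m%n≡m x<n)

    orbit-period-+ : ∀ {x} → x < n → ∀ j → orbit x (p ℕ.+ j) ≡ orbit x j
    orbit-period-+ {x} x<n j =
      trans (sym (orbit-orbit x p j)) (cong (λ y → orbit y j) (orbit-period x<n))

    orbit-periods : ∀ {x} → x < n → ∀ m → orbit x (m ℕ.* p) ≡ x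
    orbit-periods x<n zero = orbit-identity x<n
    orbit-periods x<n (suc m) = trans (orbit-period-+ x<n (m ℕ.* p)) (orbit-periods x<n m)

    orbit-inverse : ∀ {x} → x < n → ∀ j → orbit (orbit x j) (k ℕ.* j) ≡ x
    orbit-inverse {x} x<n j =
      trans (orbit-orbit x j (k ℕ.* j)) (trans (cong (orbit x) (ℕP.*-comm p j)) (orbit-periods x<n j))

    orbit-mod : ∀ x j → orbit x j ≡ orbit x (j % p)
    orbit-mod x j = trans (cong (orbit x) (m≡m%n+[m/n]*n j p))
                      (trans (sym (orbit-orbit x (j % p) (j / p ℕ.* p)))
                             (orbit-periods (orbit-< x (j % p)) (j / p)))

    coset-sym : ∀ {x y} → x < n → Coset x y → Coset y x
    coset-sym x<n (i , refl) = k ℕ.* i , sym (orbit-inverse x<n i)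

    coset-nonzero : ∀ {x y} → 1 ≤ x → x < n → Coset x y → 1 ≤ y
    coset-nonzero {x} 1≤x x<n x~y with coset-sym {x} x<n x~y
    ... | j , x≡orbit-y-j = ℕP.n≢0⇒n>0 (λ y≡0 →
      ℕP.<⇒≢ 1≤x (sym (trans x≡orbit-y-j (trans (cong (λ z → orbit z j) y≡0) (orbit-of-0 j)))))

    least-exponent : ℕ → ℕ
    least-exponent x = argmin (orbit x) 0 (upTo p)

    least : ℕ → ℕ
    least x = orbit x (least-exponent x)

    least-∈ : ∀ x → Coset x (least x)
    least-∈ x = least-exponent x , refl

    least-≤ : ∀ {x y} → Coset x y → least x ≤ y
    least-≤ {x} (j , refl) = subst (least x ≤_) (sym (orbit-mod x j))
      (lookup (f[argmin]≤f[xs] {f = orbit x} 0 (upTo p)) (∈-upTo⁺ (m%n<n j p)))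

    least-cong : ∀ {x y} → x < n → Coset x y → least x ≡ least y
    least-cong {x} {y} x<n x~y =
      ℕP.≤-antisym (least-≤ {x} (coset-trans {x} x~y (least-∈ y)))
                   (least-≤ {y} (coset-trans {y} (coset-sym {x} x<n x~y) (least-∈ x)))

    least-≡⇒coset : ∀ {x y} → y < n → least x ≡ least y → Coset x y
    least-≡⇒coset {x} {y} y<n least-x≡least-y =
      coset-trans {x} (subst (Coset x) least-x≡least-y (least-∈ x)) (coset-sym {y} y<n (least-∈ y))

    coprime⇒fixesNoCoset : ∀ b → (∀ i → 1 ≤ i → ℤC.Coprime (+ n) (+ (g ^ i) - b)) → FixesNoCoset b
    coprime⇒fixesNoCoset b coprime s 1≤s s<n (j , μs≡orbit-s-j) = >⇒∤ {{ℕ.>-nonZero 1≤s}} s<n n∣s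
      where
      i : ℕ
      i = p ℕ.+ j
      s*g^i≈b*s : + s * + (g ^ i) ≈ b * + s
      s*g^i≈b*s = begin
        + s * + (g ^ i)   ≈⟨ ≈-sym (orbit-≈ s i) ⟩
        + orbit s i       ≡⟨ cong +_ (trans (orbit-period-+ s<n j) (sym μs≡orbit-s-j)) ⟩
        + μ b s           ≈⟨ ≈-sym (≈-%ℕ (b * + s)) ⟩
        b * + s           ∎
      n∣s : n ∣ s
      n∣s = ℤC.coprime-divisor (+ n) (+ (g ^ i) - b) (+ s) (coprime i (ℕ.s≤s ℕ.z≤n))
              (S.∣⇒∣ᵤ (Equivalence.to (≈⇔∣-* (+ (g ^ i)) b (+ s)) s*g^i≈b*s))

    module Involution (t : ℤ) (j₀ : ℕ) (t²≈g^j₀ : t * t ≈ + (g ^ j₀)) where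
      μ² : ∀ x → μ t (μ t x) ≡ orbit x j₀
      μ² x = proj₂ (≈⇒coset x j₀ (begin
        t * + μ t x         ≈⟨ *-congˡ t (≈-sym (≈-%ℕ (t * + x))) ⟩
        t * (t * + x)       ≡⟨ ℤP.*-assoc t t (+ x) ⟨
        t * t * + x         ≈⟨ *-congʳ (+ x) t²≈g^j₀ ⟩
        + (g ^ j₀) * + x    ≡⟨ ℤP.*-comm (+ (g ^ j₀)) (+ x) ⟩
        + x * + (g ^ j₀)    ∎))

      μ-positive : ∀ {x} → 1 ≤ x → x < n → 1 ≤ μ t x
      μ-positive {x} 1≤x x<n = ℕP.n≢0⇒n>0 (λ μx≡0 →
        ℕP.<⇒≢ (coset-nonzero {x} 1≤x x<n (j₀ , μ² x)) (sym (trans (cong (μ t) μx≡0) (μ-zero t))))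

      μ-preimage : ∀ {y} → y < n → μ t (orbit (μ t y) (k ℕ.* j₀)) ≡ y
      μ-preimage {y} y<n = trans (μ-orbit t (μ t y) (k ℕ.* j₀))
                             (trans (cong (λ z → orbit z (k ℕ.* j₀)) (μ² y)) (orbit-inverse y<n j₀))

      Side : (ℕ → ℕ → Set) → ℕ → Set
      Side R x = 1 ≤ x × x < n × R (least x) (least (μ t x))

      Side-isUnion : ∀ R → IsUnionOfCosets q n (Side R)
      Side-isUnion R = (λ _ → proj₁ ∘ proj₂) , closed
        where
        closed : ∀ s → Side R s → ∀ x → Coset s x → Side R x
        closed s (1≤s , s<n , r) x s~x =
          coset-nonzero {s} 1≤s s<n s~x , coset-< {s} s~x ,
          subst₂ R (least-cong {s} s<n s~x) (least-cong {μ t s} (μ-< t s) (μ-coset t {s} s~x)) r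

      Side-image : ∀ R → MulSetEq n t (Side (flip R)) (Side R)
      Side-image R y = mk⇔ preimage image
        where
        preimage : Side R y → ∃ λ s → Side (flip R) s × y ≡ μ t s
        preimage (1≤y , y<n , r) = s , (1≤s , orbit-< (μ t y) (k ℕ.* j₀) , r′) , sym (μ-preimage y<n)
          where
          s : ℕ
          s = orbit (μ t y) (k ℕ.* j₀)
          1≤s : 1 ≤ s
          1≤s = coset-nonzero {μ t y} (μ-positive 1≤y y<n) (μ-< t y) (k ℕ.* j₀ , refl)
          r′ : R (least (μ t s)) (least s)
          r′ = subst₂ R (cong least (sym (μ-preimage y<n)))
                        (least-cong {μ t y} (μ-< t y) (k ℕ.* j₀ , refl)) r
        image : (∃ λ s → Side (flip R) s × y ≡ μ t s) → Side R y
        image (s , (1≤s , s<n , r) , refl) =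
          μ-positive 1≤s s<n , μ-< t s , subst (R (least (μ t s))) (least-cong {s} s<n (j₀ , μ² s)) r

      fixesNoCoset⇒splitting : FixesNoCoset t → GivesSplitting q n t
      fixesNoCoset⇒splitting fixes =
        Side _<_ , Side _>_ , Side-isUnion _<_ , Side-isUnion _>_ , cover , disjoint ,
        Side-image _>_ , Side-image _<_
        where
        cover : ∀ x → (Side _<_ x ⊎ Side _>_ x) ⇔ (1 ≤ x × x < n)
        cover x = mk⇔ Sum.[ (λ (1≤x , x<n , _) → 1≤x , x<n) , (λ (1≤x , x<n , _) → 1≤x , x<n) ]
                      (λ (1≤x , x<n) → Sum.map (λ lt → 1≤x , x<n , lt) (λ gt → 1≤x , x<n , gt)
                                         (≢⇒<⊎> (fixes x 1≤x x<n ∘ least-≡⇒coset {x} (μ-< t x))))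
        disjoint : ∀ x → Side _<_ x → Side _>_ x → ⊥
        disjoint x (_ , _ , lt) (_ , _ , gt) = ℕP.<-asym lt gt

-- Opened only here because the modules above use the multiplication of ℤ unqualified.
open import Data.Nat using (_*_)

-- Only gcd(n, q) = 1 and t² ≡ q^(2 j₀) (mod n) are used.
proposition5p5 : (q n : ℕ) .{{_ : NonZero n}} → IsPrimePower q → ¬ (2 ∣ n) → gcd n q ≡ 1 →
    (t : ℤ) → ℤG.gcd t (+ n) ≡ + 1 →
    (∀ j → ¬ ((+ n) ℤD.∣ (t - + ((q ^ 2) ^ j)))) →
    (∃ λ j → (+ n) ℤD.∣ (t ℤ.* t - + ((q ^ 2) ^ j))) →
    (GivesSplitting q n t ⇔ (∀ i → 1 ≤ i → ℤG.gcd (+ n) (+ (q ^ (2 * i)) - t) ≡ + 1))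
proposition5p5 q n _ _ gcd[n,q]≡1 t _ _ (j₀ , n∣t²-g^j₀) = mk⇔
    (λ split i _ → Equivalence.from (gcd-condition i)
                     (fixesNoCoset⇒coprime t (splitting⇒fixesNoCoset t split) i))
    (λ gcd≡1 → fixesNoCoset⇒splitting
                 (coprime⇒fixesNoCoset t (λ i 1≤i → Equivalence.to (gcd-condition i) (gcd≡1 i 1≤i))))
  where
  open Congruence n using (_≈_; mk≈; period)
  open Cyclotomic q n
  g-period : ∃ λ k → + (g ^ suc k) ≈ + 1
  g-period = period (coprime-^ (ℕC.gcd≡1⇒coprime gcd[n,q]≡1) 2)
  t²≈g^j₀ : t ℤ.* t ≈ + (g ^ j₀)
  t²≈g^j₀ = mk≈ (S.∣ᵤ⇒∣ n∣t²-g^j₀)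
  open Periodic (proj₁ g-period) (proj₂ g-period)
  open Involution t j₀ t²≈g^j₀
  gcd-condition : ∀ i → ℤG.gcd (+ n) (+ (q ^ (2 * i)) - t) ≡ + 1 ⇔ ℤC.Coprime (+ n) (+ (g ^ i) - t)
  gcd-condition i = subst (λ e → ℤG.gcd (+ n) (+ e - t) ≡ + 1 ⇔ ℤC.Coprime (+ n) (+ (g ^ i) - t))
                          (ℕP.^-*-assoc q 2 i) (gcd≡1⇔coprime (+ n) (+ (g ^ i) - t))
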